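{- Every 2-colouring of $\mathbb{N}$ has infinitely many monochromatic solutions to $x+y=z^2$. Moreover, there exists $N_0$ such that for every integer $N\ge N_0$ and every 2-colouring of the integer interval $[N,10^4N^4]$, there exist $x,y,z\in[N,10^4N^4]$, all of the same colour, with $x+y=z^2$.
   Context: $\mathbb{N}$ denotes the positive integers. An interval $[a,b]$ denotes the set of integers that are at least $a$ and at most $b$. A 2-colouring of a set is a function from the set to a two-element set; a solution $(x,y,z)$ is monochromatic if $x,y,z$ all receive the same colour. The variables $x,y,z$ need not be distinct. -}

module Defs where

open import Data.Nat using (ℕ; _+_; _*_; _^_; _≤_; _<_)
open import Data.Bool using (Bool)
open import Data.Product using (_×_; ∃-syntax)
open import Relation.Binary.PropositionalEquality using (_≡_)

-- A 2-colouring is a function into Bool; a colouring of a subset S of ℕ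
-- is represented by any function ℕ → Bool (only its values on S matter).

MonoSol : (ℕ → Bool) → ℕ → ℕ → ℕ → Set
MonoSol c x y z = (x + y ≡ z ^ 2) × (c x ≡ c y) × (c y ≡ c z)

Pos : ℕ → Set
Pos n = 1 ≤ n

InInterval : ℕ → ℕ → ℕ → Set
InInterval a b n = (a ≤ n) × (n ≤ b)

-- The set of monochromatic solutions in positive integers is infinite:
-- it is not contained in any finite box, i.e. for every bound B there is a
-- solution with x + y + z > B.
InfinitelyManyMonoSols : (ℕ → Bool) → Set
InfinitelyManyMonoSols c =
  (B : ℕ) → ∃[ x ] ∃[ y ] ∃[ z ]
    (Pos x × Pos y × Pos z × B < x + y + z × MonoSol c x y z)

{-# OPTIONS --safe #-}
module Submission where

-- Suppose c has no monochromatic solution in [N, 10⁴N⁴]. Then x + y = z² and c x = c z force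
-- c y ≠ c z whenever N ≤ x, y and N ≤ z ≤ 100N². Let [N, s] be the initial run of the colour
-- A = c N. A few such identities show that 2s < N², that the next run has some length ℓ ≤ s + N,
-- and that beyond s the colouring consists of alternating blocks of length exactly ℓ: a run
-- shorter than its predecessor would start an infinite descent of ever shorter runs.
-- If s ≥ 3N, a point of colour A just above N² - s completes, with z = N or z = N + 1, to a
-- monochromatic solution whose x lies in [N, s]. If s < 3N, for z = s + 1 or z = s + 2 the
-- number z² - 2(s + 1) splits as u + v + (an even number of blocks) with u, v < ℓ, which places
-- x and y in blocks of the colour of z; (s + 2)² - (s + 1)² being odd rules out the one exception.
-- Finally, existence of a solution in a finite box is decidable, so the contradiction yields one.

open import Defs
open import Data.Nat using (ℕ; zero; suc; _+_; _*_; _∸_; _^_; _≤_; _<_; z≤n; s≤s; NonZero)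
open import Data.Nat.Properties
open import Data.Nat.DivMod using (_/_; _%_; m≡m%n+[m/n]*n; m%n<n)
open import Data.Nat.Induction using (<-wellFounded)
open import Data.Nat.Tactic.RingSolver using (solve-∀)
open import Data.Bool using (Bool; not)
open import Data.Bool.Properties using (not-involutive; not-¬; ¬-not) renaming (_≟_ to _≟ᵇ_)
open import Data.Product using (_×_; ∃-syntax; _,_; proj₁; proj₂; ∃)
open import Data.Empty using (⊥; ⊥-elim)
open import Data.Sum.Base using ([_,_]′)
open import Induction.WellFounded using (Acc; acc)
open import Relation.Nullary using (¬_; Dec; yes; no)
open import Relation.Nullary.Decidable.Core using (map′; _×-dec_; decidable-stable)
open import Relation.Binary.PropositionalEquality

b≢not-b : ∀ {b} → b ≡ not b → ⊥
b≢not-b = not-¬ refl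

first-switch : (f : ℕ → Bool) (k a : ℕ) {b : Bool} → f a ≡ b → f (a + k) ≡ not b →
               ∃[ m ] m < k × (∀ i → i ≤ m → f (a + i) ≡ b) × f (a + suc m) ≡ not b
first-switch f zero a fa≡b fa+0≡¬b =
  ⊥-elim (b≢not-b (trans (sym fa≡b) (trans (cong f (sym (+-identityʳ a))) fa+0≡¬b)))
first-switch f (suc k) a {b} fa≡b fa+k≡¬b with f (suc a) ≟ᵇ b
... | no fa+1≢b = 0 , s≤s z≤n , at-a , trans (cong f (+-comm a 1)) (¬-not fa+1≢b)
  where
  at-a : ∀ i → i ≤ 0 → f (a + i) ≡ b
  at-a .zero z≤n = trans (cong f (+-identityʳ a)) fa≡b
... | yes fa+1≡b with first-switch f k (suc a) fa+1≡b (trans (cong f (sym (+-suc a k))) fa+k≡¬b)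
...   | m , m<k , constant , switch = suc m , s≤s m<k , extended , trans (cong f (+-suc a (suc m))) switch
  where
  extended : ∀ i → i ≤ suc m → f (a + i) ≡ b
  extended zero _ = trans (cong f (+-identityʳ a)) fa≡b
  extended (suc i) (s≤s i≤m) = trans (cong f (+-suc a i)) (constant i i≤m)

divide-above : ∀ a d .{{_ : NonZero d}} {n} → a ≤ n → ∃[ q ] ∃[ r ] r < d × n ≡ a + r + q * d
divide-above a d {n} a≤n = (n ∸ a) / d , (n ∸ a) % d , m%n<n (n ∸ a) d ,
  trans (sym (m+[n∸m]≡n a≤n)) (trans (cong (a +_) (m≡m%n+[m/n]*n (n ∸ a) d)) (sym (+-assoc a _ _)))

split-below : ∀ ℓ r → suc r < 2 * ℓ → ∃[ u ] ∃[ v ] u + v ≡ r × u < ℓ × v < ℓ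
split-below (suc k) r r+1<2ℓ with r <? suc k
... | yes r<ℓ = r , 0 , +-identityʳ r , r<ℓ , s≤s z≤n
... | no r≮ℓ = k , r ∸ k , m+[n∸m]≡n k≤r , ≤-refl ,
               s≤s (+-cancelˡ-≤ k (r ∸ k) k (subst (_≤ k + k) (sym (m+[n∸m]≡n k≤r)) r≤k+k))
  where
  k≤r : k ≤ r
  k≤r = ≤-trans (n≤1+n k) (≮⇒≥ r≮ℓ)
  double : ∀ k → 2 * suc k ≡ suc (suc (k + k))
  double = solve-∀
  r≤k+k : r ≤ k + k
  r≤k+k = ≤-pred (≤-pred (subst (suc (suc r) ≤_) (double k) r+1<2ℓ))

MonoSolutionIn : ℕ → (ℕ → Bool) → Set
MonoSolutionIn N c = ∃[ x ] ∃[ y ] ∃[ z ]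
  (InInterval N (10000 * N ^ 4) x × InInterval N (10000 * N ^ 4) y
    × InInterval N (10000 * N ^ 4) z × MonoSol c x y z)

mono-solution-in? : ∀ N c → Dec (MonoSolutionIn N c)
mono-solution-in? N c = map′ drop-bounds add-bounds
  (anyUpTo? (λ x → anyUpTo? (λ y → anyUpTo? (solution? x y) (suc U)) (suc U)) (suc U))
  where
  U : ℕ
  U = 10000 * N ^ 4
  Solution : ℕ → ℕ → ℕ → Set
  Solution x y z = InInterval N U x × InInterval N U y × InInterval N U z × MonoSol c x y z
  in? : ∀ n → Dec (InInterval N U n)
  in? n = (N ≤? n) ×-dec (n ≤? U)
  solution? : ∀ x y z → Dec (Solution x y z)
  solution? x y z = in? x ×-dec in? y ×-dec in? z
    ×-dec ((x + y ≟ z ^ 2) ×-dec (c x ≟ᵇ c y) ×-dec (c y ≟ᵇ c z))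
  Bounded : Set
  Bounded = ∃[ x ] x < suc U × ∃[ y ] y < suc U × ∃[ z ] z < suc U × Solution x y z
  drop-bounds : Bounded → MonoSolutionIn N c
  drop-bounds (x , _ , y , _ , z , _ , sol) = x , y , z , sol
  add-bounds : MonoSolutionIn N c → Bounded
  add-bounds (x , y , z , sol@((_ , x≤U) , (_ , y≤U) , (_ , z≤U) , _)) =
    x , s≤s x≤U , y , s≤s y≤U , z , s≤s z≤U , sol

square-of-scaled-square : ∀ a N → (a * N * N) * (a * N * N) ≡ a * a * (N * (N * (N * (N * 1))))
square-of-scaled-square = solve-∀

FlipsOnSquareSums : ℕ → (ℕ → Bool) → Set
FlipsOnSquareSums N c = ∀ {x y z} → N ≤ x → N ≤ y → N ≤ z → z ≤ 100 * N * N →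
                        x + y ≡ z * z → c x ≡ c z → c y ≡ not (c z)

-- z ≤ 100N² keeps x, y, z below (100N²)² = 10⁴N⁴.
no-mono-solution⇒flips : ∀ {N c} → 1 ≤ N → ¬ MonoSolutionIn N c → FlipsOnSquareSums N c
no-mono-solution⇒flips {N} {c} 1≤N no-solution {x} {y} {z} N≤x N≤y N≤z z≤Z x+y≡z² cx≡cz = ¬-not λ cy≡cz →
  no-solution (x , y , z , (N≤x , x≤U) , (N≤y , y≤U) , (N≤z , z≤U) , (x+y≡z^2 , trans cx≡cz (sym cy≡cz) , cy≡cz))
  where
  z²≤U : z * z ≤ 10000 * N ^ 4
  z²≤U = subst (z * z ≤_) (square-of-scaled-square 100 N) (*-mono-≤ z≤Z z≤Z)
  x≤U : x ≤ 10000 * N ^ 4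
  x≤U = ≤-trans (subst (x ≤_) x+y≡z² (m≤m+n x y)) z²≤U
  y≤U : y ≤ 10000 * N ^ 4
  y≤U = ≤-trans (subst (y ≤_) x+y≡z² (m≤n+m y x)) z²≤U
  z≤U : z ≤ 10000 * N ^ 4
  z≤U = ≤-trans (subst (_≤ z * z) (*-identityʳ z) (*-monoʳ-≤ z (≤-trans 1≤N N≤z))) z²≤U
  x+y≡z^2 : x + y ≡ z ^ 2
  x+y≡z^2 = trans x+y≡z² (cong (z *_) (sym (*-identityʳ z)))

module FlippingColouring (N : ℕ) (10≤N : 10 ≤ N) (c : ℕ → Bool) (flip-colour : FlipsOnSquareSums N c) where

  Z : ℕ
  Z = 100 * N * N

  1≤N : 1 ≤ N
  1≤N = ≤-trans (s≤s z≤n) 10≤N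

  -- For x = σ + 2d + 1, f = σ² - x and g = 2σd + d² + x we have (σ+1) + σ(σ+1) = (σ+1)²,
  -- x + f = σ², f + g = (σ+d)² and σ(σ+1) + g = (σ+d+1)²; if c x = a, they give c g = a ≠ c g.
  switches⇒colour-ahead : ∀ σ d {a} → N ≤ σ → d ≤ σ + N → suc (σ + d) ≤ Z →
    c σ ≡ a → c (suc σ) ≡ not a → c (σ + d) ≡ not a → c (suc (σ + d)) ≡ a →
    c (σ + 2 * d + 1) ≡ not a
  switches⇒colour-ahead σ d {a} N≤σ d≤σ+N bound cσ cσ+1 cτ cτ+1 =
    ¬-not (λ cx≡a → b≢not-b (trans (sym (cg≡a cx≡a)) cg≡¬a))
    where
    x : ℕ
    x = σ + 2 * d + 1
    x+N≤σ² : x + N ≤ σ * σ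
    x+N≤σ² = begin
        (σ + 2 * d + 1) + N       ≤⟨ +-mono-≤ (+-monoˡ-≤ 1 (+-monoʳ-≤ σ (*-monoʳ-≤ 2 (≤-trans d≤σ+N (+-monoʳ-≤ σ N≤σ))))) N≤σ ⟩
        (σ + 2 * (σ + σ) + 1) + σ ≡⟨ collect σ ⟩
        6 * σ + 1                 ≤⟨ +-monoʳ-≤ (6 * σ) (≤-trans 1≤N N≤σ) ⟩
        6 * σ + σ                 ≡⟨ +-comm (6 * σ) σ ⟩
        7 * σ                     ≤⟨ *-monoˡ-≤ σ (≤-trans (m≤n+m 7 3) (≤-trans 10≤N N≤σ)) ⟩
        σ * σ                     ∎
      where
      open ≤-Reasoning
      collect : ∀ σ → (σ + 2 * (σ + σ) + 1) + σ ≡ 6 * σ + 1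
      collect = solve-∀
    f : ℕ
    f = σ * σ ∸ x
    x+f≡σ² : x + f ≡ σ * σ
    x+f≡σ² = m+[n∸m]≡n (≤-trans (m≤m+n x N) x+N≤σ²)
    N≤f : N ≤ f
    N≤f = +-cancelˡ-≤ x N f (subst (x + N ≤_) (sym x+f≡σ²) x+N≤σ²)
    e : ℕ
    e = suc σ * σ
    g : ℕ
    g = 2 * σ * d + d * d + x
    N≤x : N ≤ x
    N≤x = ≤-trans N≤σ (≤-trans (m≤m+n σ (2 * d)) (m≤m+n (σ + 2 * d) 1))
    N≤σ+1 : N ≤ suc σ
    N≤σ+1 = ≤-trans N≤σ (n≤1+n σ)
    N≤τ : N ≤ σ + d
    N≤τ = ≤-trans N≤σ (m≤m+n σ d)
    τ≤Z : σ + d ≤ Z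
    τ≤Z = ≤-trans (n≤1+n _) bound
    ce≡a : c e ≡ a
    ce≡a = trans (flip-colour N≤σ+1 (≤-trans N≤σ (m≤m+n σ (σ * σ))) N≤σ+1
                   (≤-trans (s≤s (m≤m+n σ d)) bound) (sum₁ σ) refl)
                 (trans (cong not cσ+1) (not-involutive a))
      where
      sum₁ : ∀ σ → suc σ + suc σ * σ ≡ suc σ * suc σ
      sum₁ = solve-∀
    cf≡¬a : c x ≡ a → c f ≡ not a
    cf≡¬a cx = trans (flip-colour N≤x N≤f N≤σ (≤-trans (m≤m+n σ d) τ≤Z) x+f≡σ² (trans cx (sym cσ)))
                  (cong not cσ)
    f+g≡τ² : f + g ≡ (σ + d) * (σ + d)
    f+g≡τ² = begin
      f + (2 * σ * d + d * d + x)   ≡⟨ +-comm f _ ⟩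
      (2 * σ * d + d * d + x) + f   ≡⟨ +-assoc (2 * σ * d + d * d) x f ⟩
      (2 * σ * d + d * d) + (x + f) ≡⟨ cong ((2 * σ * d + d * d) +_) x+f≡σ² ⟩
      (2 * σ * d + d * d) + σ * σ   ≡⟨ square-of-sum σ d ⟩
      (σ + d) * (σ + d)             ∎
      where
      open ≡-Reasoning
      square-of-sum : ∀ σ d → (2 * σ * d + d * d) + σ * σ ≡ (σ + d) * (σ + d)
      square-of-sum = solve-∀
    N≤g : N ≤ g
    N≤g = ≤-trans N≤x (m≤n+m x (2 * σ * d + d * d))
    cg≡a : c x ≡ a → c g ≡ a
    cg≡a cx = trans (flip-colour N≤f N≤g N≤τ τ≤Z f+g≡τ² (trans (cf≡¬a cx) (sym cτ)))
                 (trans (cong not cτ) (not-involutive a))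
    cg≡¬a : c g ≡ not a
    cg≡¬a = trans (flip-colour (≤-trans N≤σ (m≤m+n σ (σ * σ))) N≤g (≤-trans N≤τ (n≤1+n _)) bound
                    (sum₄ σ d) (trans ce≡a (sym cτ+1)))
                  (cong not cτ+1)
      where
      sum₄ : ∀ σ d → suc σ * σ + (2 * σ * d + d * d + (σ + 2 * d + 1)) ≡ suc (σ + d) * suc (σ + d)
      sum₄ = solve-∀

  -- For e₀ = τ² - τ, f = τ² + x + 4e + 1 and g = 2xe + 5e² + x + 2e we have τ + e₀ = τ²,
  -- x + f = (τ+1)², f + g = (σ+1)² and e₀ + g = σ²; if c x = a, they give c g = a ≠ c g.
  switches⇒colour-behind : ∀ x e {τ σ a} → τ ≡ x + 2 * e → σ ≡ x + 3 * e → N ≤ x → suc σ ≤ Z →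
    c σ ≡ a → c (suc σ) ≡ not a → c τ ≡ not a → c (suc τ) ≡ a → c x ≡ not a
  switches⇒colour-behind x e {a = a} refl refl N≤x bound cσ cσ+1 cτ cτ+1 =
    ¬-not (λ cx≡a → b≢not-b (trans (sym (cg≡a cx≡a)) cg≡¬a))
    where
    τ σ : ℕ
    τ = x + 2 * e
    σ = x + 3 * e
    τ≤σ : τ ≤ σ
    τ≤σ = +-monoʳ-≤ x (*-monoˡ-≤ e (s≤s (s≤s (z≤n {1}))))
    σ≤Z : σ ≤ Z
    σ≤Z = ≤-trans (n≤1+n σ) bound
    N≤τ : N ≤ τ
    N≤τ = ≤-trans N≤x (m≤m+n x (2 * e))
    N≤σ : N ≤ σ
    N≤σ = ≤-trans N≤x (m≤m+n x (3 * e))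
    τ+τ≤τ² : τ + τ ≤ τ * τ
    τ+τ≤τ² = ≤-trans (≤-reflexive (cong (τ +_) (sym (+-identityʳ τ))))
                     (*-monoˡ-≤ τ (≤-trans (m≤n+m 2 8) (≤-trans 10≤N N≤τ)))
    e₀ : ℕ
    e₀ = τ * τ ∸ τ
    τ+e₀≡τ² : τ + e₀ ≡ τ * τ
    τ+e₀≡τ² = m+[n∸m]≡n (≤-trans (m≤m+n τ τ) τ+τ≤τ²)
    N≤e₀ : N ≤ e₀
    N≤e₀ = ≤-trans N≤τ (+-cancelˡ-≤ τ τ e₀ (subst (τ + τ ≤_) (sym τ+e₀≡τ²) τ+τ≤τ²))
    f g : ℕ
    f = τ * τ + x + 4 * e + 1
    g = 2 * x * e + 5 * e * e + x + 2 * e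
    N≤f : N ≤ f
    N≤f = ≤-trans N≤x (≤-trans (m≤n+m x (τ * τ)) (≤-trans (m≤m+n (τ * τ + x) (4 * e)) (m≤m+n (τ * τ + x + 4 * e) 1)))
    N≤g : N ≤ g
    N≤g = ≤-trans N≤x (≤-trans (m≤n+m x (2 * x * e + 5 * e * e)) (m≤m+n (2 * x * e + 5 * e * e + x) (2 * e)))
    e₀+g≡σ² : e₀ + g ≡ σ * σ
    e₀+g≡σ² = +-cancelˡ-≡ τ (e₀ + g) (σ * σ) (begin
      τ + (e₀ + g)  ≡⟨ +-assoc τ e₀ g ⟨
      τ + e₀ + g    ≡⟨ cong (_+ g) τ+e₀≡τ² ⟩
      τ * τ + g     ≡⟨ expand x e ⟩
      τ + σ * σ     ∎)
      where
      open ≡-Reasoning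
      expand : ∀ x e → (x + 2 * e) * (x + 2 * e) + (2 * x * e + 5 * e * e + x + 2 * e)
                       ≡ (x + 2 * e) + (x + 3 * e) * (x + 3 * e)
      expand = solve-∀
    x+f≡[τ+1]² : ∀ x e → x + ((x + 2 * e) * (x + 2 * e) + x + 4 * e + 1) ≡ suc (x + 2 * e) * suc (x + 2 * e)
    x+f≡[τ+1]² = solve-∀
    f+g≡[σ+1]² : ∀ x e → ((x + 2 * e) * (x + 2 * e) + x + 4 * e + 1) + (2 * x * e + 5 * e * e + x + 2 * e)
                         ≡ suc (x + 3 * e) * suc (x + 3 * e)
    f+g≡[σ+1]² = solve-∀
    ce₀≡a : c e₀ ≡ a
    ce₀≡a = trans (flip-colour N≤τ N≤e₀ N≤τ (≤-trans τ≤σ σ≤Z) τ+e₀≡τ² refl)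
                  (trans (cong not cτ) (not-involutive a))
    cf≡¬a : c x ≡ a → c f ≡ not a
    cf≡¬a cx = trans (flip-colour N≤x N≤f (≤-trans N≤τ (n≤1+n τ)) (≤-trans (s≤s τ≤σ) bound)
                     (x+f≡[τ+1]² x e) (trans cx (sym cτ+1)))
                  (cong not cτ+1)
    cg≡a : c x ≡ a → c g ≡ a
    cg≡a cx = trans (flip-colour N≤f N≤g (≤-trans N≤σ (n≤1+n σ)) bound (f+g≡[σ+1]² x e) (trans (cf≡¬a cx) (sym cσ+1)))
                 (trans (cong not cσ+1) (not-involutive a))
    cg≡¬a : c g ≡ not a
    cg≡¬a = trans (flip-colour N≤e₀ N≤g N≤σ σ≤Z e₀+g≡σ² (trans ce₀≡a (sym cσ))) (cong not cσ)

  -- N + f = s² and f + (2s + 1 + N) = (s+1)².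
  colour-at-2s+1+N : ∀ s {a} → N ≤ s → suc s ≤ Z → c N ≡ a → c s ≡ a → c (suc s) ≡ not a →
    c (2 * s + 1 + N) ≡ a
  colour-at-2s+1+N s {a} N≤s bound cN cs cs+1 =
    trans (flip-colour N≤f (m≤n+m N (2 * s + 1)) (≤-trans N≤s (n≤1+n s)) bound f+[2s+1+N]≡[s+1]²
                       (trans cf≡¬a (sym cs+1)))
          (trans (cong not cs+1) (not-involutive a))
    where
    N+N≤s² : N + N ≤ s * s
    N+N≤s² = ≤-trans (+-mono-≤ N≤s (≤-trans N≤s (≤-reflexive (sym (+-identityʳ s)))))
                     (*-monoˡ-≤ s (≤-trans (m≤n+m 2 8) (≤-trans 10≤N N≤s)))
    f : ℕ
    f = s * s ∸ N
    N+f≡s² : N + f ≡ s * s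
    N+f≡s² = m+[n∸m]≡n (≤-trans (m≤m+n N N) N+N≤s²)
    N≤f : N ≤ f
    N≤f = +-cancelˡ-≤ N N f (subst (N + N ≤_) (sym N+f≡s²) N+N≤s²)
    cf≡¬a : c f ≡ not a
    cf≡¬a = trans (flip-colour ≤-refl N≤f N≤s (≤-trans (n≤1+n s) bound) N+f≡s² (trans cN (sym cs)))
                  (cong not cs)
    f+[2s+1+N]≡[s+1]² : f + (2 * s + 1 + N) ≡ suc s * suc s
    f+[2s+1+N]≡[s+1]² = begin
      f + (2 * s + 1 + N)   ≡⟨ rearrange f (2 * s + 1) N ⟩
      (N + f) + (2 * s + 1) ≡⟨ cong (_+ (2 * s + 1)) N+f≡s² ⟩
      s * s + (2 * s + 1)   ≡⟨ square-of-successor s ⟩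
      suc s * suc s         ∎
      where
      open ≡-Reasoning
      rearrange : ∀ f t N → f + (t + N) ≡ (N + f) + t
      rearrange = solve-∀
      square-of-successor : ∀ s → s * s + (2 * s + 1) ≡ suc s * suc s
      square-of-successor = solve-∀

  Run : ℕ → ℕ → Bool → Set
  Run β ℓ b = ∀ i → i < ℓ → c (suc β + i) ≡ b

  run-first : ∀ {β ℓ b} → 1 ≤ ℓ → Run β ℓ b → c (suc β) ≡ b
  run-first {β} 1≤ℓ run = trans (cong c (sym (+-identityʳ (suc β)))) (run 0 1≤ℓ)

  run-last : ∀ {β k b} → Run β (suc k) b → c (β + suc k) ≡ b
  run-last {β} {k} run = trans (cong c (+-suc β k)) (run k ≤-refl)

  run-at : ∀ {β ℓ b x} → Run β ℓ b → β < x → x ≤ β + ℓ → c x ≡ b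
  run-at {β} {ℓ} {x = x} run β<x x≤β+ℓ = trans (cong c (sym β+1+i≡x)) (run i i<ℓ)
    where
    i : ℕ
    i = x ∸ suc β
    β+1+i≡x : suc β + i ≡ x
    β+1+i≡x = m+[n∸m]≡n β<x
    i<ℓ : i < ℓ
    i<ℓ = +-cancelˡ-≤ (suc β) (suc i) ℓ
            (subst (_≤ suc β + ℓ) (sym (trans (+-suc (suc β) i) (cong suc β+1+i≡x))) (s≤s x≤β+ℓ))

  next-run : ∀ τ k {b} → c (suc τ) ≡ b → c (suc τ + k) ≡ not b →
             ∃[ m ] m < k × Run τ (suc m) b × c (suc τ + suc m) ≡ not b
  next-run τ k cτ+1 c-end =
    let (m , m<k , constant , switch) = first-switch c k (suc τ) cτ+1 c-end
    in m , m<k , (λ i i<1+m → constant i (≤-pred i<1+m)) , switch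

  past-run≤Z : ∀ τ ℓ k → k ≤ ℓ → τ + 2 * ℓ + 2 ≤ Z → suc (τ + ℓ + k) ≤ Z
  past-run≤Z τ ℓ k k≤ℓ bound = ≤-trans (s≤s (+-monoʳ-≤ (τ + ℓ) k≤ℓ))
    (≤-trans (≤-reflexive (rearrange τ ℓ)) (≤-trans (+-monoʳ-≤ (τ + 2 * ℓ) (n≤1+n 1)) bound))
    where
    rearrange : ∀ τ ℓ → suc (τ + ℓ + ℓ) ≡ τ + 2 * ℓ + 1
    rearrange = solve-∀

  -- The switches at τ and τ + ℓ₂ make c (τ + 2ℓ₂ + 1) = ¬C, so the third run is no longer than ℓ₂.
  third-run : ∀ β a b {C} → suc b < suc a → N ≤ β → β + suc a + 2 * suc b + 2 ≤ Z →
    Run β (suc a) C → Run (β + suc a) (suc b) (not C) → c (suc (β + suc a + suc b)) ≡ C →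
    ∃[ m ] m < suc b × Run (β + suc a + suc b) (suc m) C × c (suc (β + suc a + suc b + suc m)) ≡ not C
  third-run β a b {C} ℓ₂<ℓ₁ N≤β bound run₁ run₂ c-after =
    next-run (τ + ℓ₂) ℓ₂ c-after (trans (cong c (rearrange τ ℓ₂)) c[τ+2ℓ₂+1])
    where
    ℓ₂ τ : ℕ
    ℓ₂ = suc b
    τ = β + suc a
    rearrange : ∀ τ ℓ → suc (τ + ℓ) + ℓ ≡ τ + 2 * ℓ + 1
    rearrange = solve-∀
    c[τ+2ℓ₂+1] : c (τ + 2 * ℓ₂ + 1) ≡ not C
    c[τ+2ℓ₂+1] = switches⇒colour-ahead τ ℓ₂ (≤-trans N≤β (m≤m+n β (suc a)))
                   (≤-trans (≤-trans (<⇒≤ ℓ₂<ℓ₁) (m≤n+m (suc a) β)) (m≤m+n τ N))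
                   (≤-trans (s≤s (m≤m+n (τ + ℓ₂) 0)) (past-run≤Z τ ℓ₂ 0 z≤n bound))
                   (run-last run₁) (run-first (s≤s z≤n) run₂) (run-last run₂) c-after

  -- With ℓ₃ the length of the third run, c = ¬C at x = τ + ℓ₂ - 2ℓ₃ (τ = β + ℓ₁ the end of the
  -- first run). This x lies in the first run unless 2ℓ₃ < ℓ₂, and then the second and third runs
  -- are again a run followed by a shorter one.
  shorter-run-absurd : ∀ {b} → Acc _<_ (suc b) → ∀ β a {C} → suc b < suc a → N ≤ β →
    β + suc a + 2 * suc b + 2 ≤ Z → Run β (suc a) C → Run (β + suc a) (suc b) (not C) →
    c (suc (β + suc a + suc b)) ≡ C → ⊥
  shorter-run-absurd {b} (acc smaller) β a {C} ℓ₂<ℓ₁ N≤β bound run₁ run₂ c-after =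
    after-third (third-run β a b ℓ₂<ℓ₁ N≤β bound run₁ run₂ c-after)
    where
    ℓ₂ τ : ℕ
    ℓ₂ = suc b
    τ = β + suc a
    after-third : (∃[ m ] m < ℓ₂ × Run (τ + ℓ₂) (suc m) C × c (suc (τ + ℓ₂ + suc m)) ≡ not C) → ⊥
    after-third (m , ℓ₃≤ℓ₂ , run₃ , c-after₃) = conclude (ℓ₂ ≤? 2 * ℓ₃)
      where
      ℓ₃ x : ℕ
      ℓ₃ = suc m
      x = τ + ℓ₂ ∸ 2 * ℓ₃
      x+2ℓ₃≡τ+ℓ₂ : x + 2 * ℓ₃ ≡ τ + ℓ₂
      x+2ℓ₃≡τ+ℓ₂ = m∸n+n≡m (+-mono-≤ (≤-trans ℓ₃≤ℓ₂ (≤-trans (<⇒≤ ℓ₂<ℓ₁) (m≤n+m (suc a) β)))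
                                      (≤-trans (≤-reflexive (+-identityʳ ℓ₃)) ℓ₃≤ℓ₂))
      β<x : β < x
      β<x = +-cancelʳ-≤ (2 * ℓ₃) (suc β) x (begin
        suc β + 2 * ℓ₃   ≤⟨ +-monoʳ-≤ (suc β) (*-monoʳ-≤ 2 ℓ₃≤ℓ₂) ⟩
        suc β + 2 * ℓ₂   ≡⟨ rearrange β ℓ₂ ⟩
        β + suc ℓ₂ + ℓ₂  ≤⟨ +-monoˡ-≤ ℓ₂ (+-monoʳ-≤ β ℓ₂<ℓ₁) ⟩
        τ + ℓ₂           ≡⟨ x+2ℓ₃≡τ+ℓ₂ ⟨
        x + 2 * ℓ₃       ∎)
        where
        open ≤-Reasoning
        rearrange : ∀ β ℓ → suc β + 2 * ℓ ≡ β + suc ℓ + ℓ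
        rearrange = solve-∀
      cx≡¬C : c x ≡ not C
      cx≡¬C = switches⇒colour-behind x ℓ₃ (sym x+2ℓ₃≡τ+ℓ₂)
                (trans (cong (_+ ℓ₃) (sym x+2ℓ₃≡τ+ℓ₂)) (regroup x ℓ₃))
                (≤-trans N≤β (<⇒≤ β<x)) (past-run≤Z τ ℓ₂ ℓ₃ ℓ₃≤ℓ₂ bound) (run-last run₃) c-after₃
                (run-last run₂) c-after
        where
        regroup : ∀ x ℓ → x + 2 * ℓ + ℓ ≡ x + 3 * ℓ
        regroup = solve-∀
      conclude : Dec (ℓ₂ ≤ 2 * ℓ₃) → ⊥
      conclude (yes ℓ₂≤2ℓ₃) = b≢not-b (trans (sym (run-at run₁ β<x x≤τ)) cx≡¬C)
        where
        x≤τ : x ≤ τ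
        x≤τ = +-cancelʳ-≤ (2 * ℓ₃) x τ (≤-trans (≤-reflexive x+2ℓ₃≡τ+ℓ₂) (+-monoʳ-≤ τ ℓ₂≤2ℓ₃))
      conclude (no ℓ₂≰2ℓ₃) = shorter-run-absurd (smaller ℓ₃<ℓ₂) τ b ℓ₃<ℓ₂ (≤-trans N≤β (m≤m+n β (suc a)))
                               bound′ run₂ (λ i i<ℓ₃ → trans (run₃ i i<ℓ₃) (sym (not-involutive C))) c-after₃
        where
        2ℓ₃<ℓ₂ : 2 * ℓ₃ < ℓ₂
        2ℓ₃<ℓ₂ = ≰⇒> ℓ₂≰2ℓ₃
        ℓ₃<ℓ₂ : ℓ₃ < ℓ₂
        ℓ₃<ℓ₂ = ≤-trans (s≤s (m≤m+n ℓ₃ (ℓ₃ + 0))) 2ℓ₃<ℓ₂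
        bound′ : τ + ℓ₂ + 2 * ℓ₃ + 2 ≤ Z
        bound′ = subst (_≤ Z) (sym (regroup (τ + ℓ₂) (2 * ℓ₃))) (past-run≤Z τ ℓ₂ (suc (2 * ℓ₃)) 2ℓ₃<ℓ₂ bound)
          where
          regroup : ∀ t k → t + k + 2 ≡ suc (t + suc k)
          regroup = solve-∀

  A : Bool
  A = c N

  2N²≤Z : 2 * N * N ≤ Z
  2N²≤Z = *-monoˡ-≤ N (*-monoˡ-≤ N (m≤m+n 2 98))

  N<2N : N < 2 * N
  N<2N = ≤-trans (≤-reflexive (+-comm 1 N)) (+-monoʳ-≤ N (≤-trans 1≤N (≤-reflexive (sym (+-identityʳ N)))))

  2N≤2N² : 2 * N ≤ 2 * N * N
  2N≤2N² = subst (_≤ 2 * N * N) (*-identityʳ (2 * N)) (*-monoʳ-≤ (2 * N) 1≤N)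

  N≤Z : N ≤ Z
  N≤Z = ≤-trans (<⇒≤ N<2N) (≤-trans 2N≤2N² 2N²≤Z)

  N≤N² : N ≤ N * N
  N≤N² = subst (_≤ N * N) (*-identityʳ N) (*-monoʳ-≤ N 1≤N)

  -- If 2N and 2N² both had colour A, so would the solution 2N² + 2N² = (2N)².
  other-colour-below-2N² : ∃[ E ] N < E × E ≤ 2 * N * N × c E ≡ not A
  other-colour-below-2N² = pick (c (2 * N) ≟ᵇ A) (c (2 * N * N) ≟ᵇ A)
    where
    N≤2N² : N ≤ 2 * N * N
    N≤2N² = ≤-trans (<⇒≤ N<2N) 2N≤2N²
    double : ∀ N → 2 * N * N + 2 * N * N ≡ (2 * N) * (2 * N)
    double = solve-∀
    pick : Dec (c (2 * N) ≡ A) → Dec (c (2 * N * N) ≡ A) → ∃[ E ] N < E × E ≤ 2 * N * N × c E ≡ not A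
    pick (no c2N≢A) _ = 2 * N , N<2N , 2N≤2N² , ¬-not c2N≢A
    pick (yes _) (no c2N²≢A) = 2 * N * N , <-≤-trans N<2N 2N≤2N² , ≤-refl , ¬-not c2N²≢A
    pick (yes c2N≡A) (yes c2N²≡A) = ⊥-elim (b≢not-b (trans (sym c2N²≡A)
      (trans (flip-colour N≤2N² N≤2N² (<⇒≤ N<2N) (≤-trans 2N≤2N² 2N²≤Z) (double N) (trans c2N²≡A (sym c2N≡A)))
             (cong not c2N≡A))))

  InitialRun : ℕ → Set
  InitialRun s = N ≤ s × s < 2 * N * N × (∀ x → N ≤ x → x ≤ s → c x ≡ A) × c (suc s) ≡ not A

  initial-run : ∃ InitialRun
  initial-run = up-to other-colour-below-2N²
    where
    up-to : (∃[ E ] N < E × E ≤ 2 * N * N × c E ≡ not A) → ∃ InitialRun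
    up-to (E , N<E , E≤2N² , cE) = from-switch (first-switch c (E ∸ N) N refl (trans (cong c (m+[n∸m]≡n (<⇒≤ N<E))) cE))
      where
      from-switch : (∃[ m ] m < E ∸ N × (∀ i → i ≤ m → c (N + i) ≡ A) × c (N + suc m) ≡ not A) → ∃ InitialRun
      from-switch (m , m<E∸N , constant , switch) =
        N + m , m≤m+n N m , ≤-trans N+m<E E≤2N² , constant′ , trans (cong c (sym (+-suc N m))) switch
        where
        N+m<E : N + m < E
        N+m<E = subst (N + m <_) (m+[n∸m]≡n (<⇒≤ N<E)) (subst (_≤ N + (E ∸ N)) (+-suc N m) (+-monoʳ-≤ N m<E∸N))
        constant′ : ∀ x → N ≤ x → x ≤ N + m → c x ≡ A
        constant′ x N≤x x≤N+m = trans (cong c (sym (m+[n∸m]≡n N≤x)))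
          (constant (x ∸ N) (+-cancelˡ-≤ N (x ∸ N) m (subst (_≤ N + m) (sym (m+[n∸m]≡n N≤x)) x≤N+m)))

  s : ℕ
  s = proj₁ initial-run

  N≤s : N ≤ s
  N≤s = proj₁ (proj₂ initial-run)

  s<2N² : s < 2 * N * N
  s<2N² = proj₁ (proj₂ (proj₂ initial-run))

  initial : ∀ x → N ≤ x → x ≤ s → c x ≡ A
  initial = proj₁ (proj₂ (proj₂ (proj₂ initial-run)))

  cs+1 : c (suc s) ≡ not A
  cs+1 = proj₂ (proj₂ (proj₂ (proj₂ initial-run)))

  cs : c s ≡ A
  cs = initial s N≤s ≤-refl

  -- Otherwise s + (N² - s) = N² with N ≤ N² - s ≤ s, or (N² - N) + N = N² with N ≤ N² - N ≤ s.
  2s<N² : 2 * s < N * N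
  2s<N² = ≰⇒> (λ N²≤2s → by-cases N²≤2s (s + N ≤? N * N))
    where
    by-cases : N * N ≤ 2 * s → Dec (s + N ≤ N * N) → ⊥
    by-cases N²≤2s (yes s+N≤N²) = b≢not-b (trans (sym (initial y N≤y y≤s)) (flip-colour N≤s N≤y ≤-refl N≤Z s+y≡N² cs))
      where
      s≤N² : s ≤ N * N
      s≤N² = ≤-trans (m≤m+n s N) s+N≤N²
      y : ℕ
      y = N * N ∸ s
      s+y≡N² : s + y ≡ N * N
      s+y≡N² = m+[n∸m]≡n s≤N²
      N≤y : N ≤ y
      N≤y = +-cancelˡ-≤ s N y (subst (s + N ≤_) (sym s+y≡N²) s+N≤N²)
      y≤s : y ≤ s
      y≤s = +-cancelˡ-≤ s y s (subst (_≤ s + s) (sym s+y≡N²) (subst (N * N ≤_) (cong (s +_) (+-identityʳ s)) N²≤2s))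
    by-cases _ (no s+N≰N²) = b≢not-b (flip-colour N≤x ≤-refl ≤-refl N≤Z x+N≡N² (initial x N≤x x≤s))
      where
      x : ℕ
      x = N * N ∸ N
      x+N≡N² : x + N ≡ N * N
      x+N≡N² = m∸n+n≡m N≤N²
      N+N≤N² : N + N ≤ N * N
      N+N≤N² = ≤-trans (≤-reflexive (cong (N +_) (sym (+-identityʳ N)))) (*-monoˡ-≤ N (≤-trans (m≤n+m 2 8) 10≤N))
      N≤x : N ≤ x
      N≤x = +-cancelʳ-≤ N N x (subst (N + N ≤_) (sym x+N≡N²) N+N≤N²)
      x≤s : x ≤ s
      x≤s = <⇒≤ (+-cancelʳ-≤ N (suc x) s (subst (λ w → suc w ≤ s + N) (sym x+N≡N²) (≰⇒> s+N≰N²)))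

  second-run : ∃[ m ] m < s + N × Run s (suc m) (not A) × c (suc s + suc m) ≡ not (not A)
  second-run = next-run s (s + N) cs+1 (trans (cong c (regroup s N)) (trans c[2s+1+N] (sym (not-involutive A))))
    where
    regroup : ∀ s N → suc s + (s + N) ≡ 2 * s + 1 + N
    regroup = solve-∀
    c[2s+1+N] : c (2 * s + 1 + N) ≡ A
    c[2s+1+N] = colour-at-2s+1+N s N≤s (≤-trans s<2N² 2N²≤Z) refl cs cs+1

  ℓ-1 ℓ : ℕ
  ℓ-1 = proj₁ second-run
  ℓ = suc ℓ-1

  ℓ≤s+N : ℓ ≤ s + N
  ℓ≤s+N = proj₁ (proj₂ second-run)

  base : ℕ → ℕ
  base zero = s
  base (suc j) = base j + ℓ

  colour : ℕ → Bool
  colour zero = not A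
  colour (suc j) = not (colour j)

  IsBlock : ℕ → Set
  IsBlock j = Run (base j) ℓ (colour j) × c (base j) ≡ not (colour j) × c (suc (base j + ℓ)) ≡ not (colour j)

  s≤base : ∀ j → s ≤ base j
  s≤base zero = ≤-refl
  s≤base (suc j) = ≤-trans (s≤base j) (m≤m+n (base j) ℓ)

  base-≡ : ∀ j → base j ≡ s + j * ℓ
  base-≡ zero = sym (+-identityʳ s)
  base-≡ (suc j) = trans (cong (_+ ℓ) (base-≡ j)) (regroup s j ℓ)
    where
    regroup : ∀ s j ℓ → (s + j * ℓ) + ℓ ≡ s + (ℓ + j * ℓ)
    regroup = solve-∀

  colour-periodic : ∀ j k → colour (j + 2 * k) ≡ colour j
  colour-periodic j zero = cong colour (+-identityʳ j)
  colour-periodic j (suc k) = trans (cong colour (regroup j k)) (trans (not-involutive _) (colour-periodic j k))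
    where
    regroup : ∀ j k → j + 2 * suc k ≡ suc (suc (j + 2 * k))
    regroup = solve-∀

  -- A shorter block j+1 would contradict shorter-run-absurd; a longer one is cut off by
  -- switches⇒colour-ahead applied to the switches at both ends of block j.
  next-block : ∀ j → IsBlock j → base (suc j) + 3 * ℓ + 2 ≤ Z → IsBlock (suc j)
  next-block j (run , c-before , c-after) bound = run′ , trans (run-last run) (sym (not-involutive _)) , c-after′
    where
    σ τ : ℕ
    σ = base j
    τ = base (suc j)
    N≤σ : N ≤ σ
    N≤σ = ≤-trans N≤s (s≤base j)
    τ+1≤Z : suc τ ≤ Z
    τ+1≤Z = ≤-trans (≤-trans (n≤1+n (suc τ)) (≤-reflexive (+-comm 2 τ))) (≤-trans (+-monoˡ-≤ 2 (m≤m+n τ (3 * ℓ))) bound)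
    c-after′ : c (suc (τ + ℓ)) ≡ not (not (colour j))
    c-after′ = trans (cong c (regroup σ ℓ))
      (switches⇒colour-ahead σ ℓ N≤σ (≤-trans ℓ≤s+N (+-monoˡ-≤ N (s≤base j))) τ+1≤Z c-before
        (trans (run-first (s≤s z≤n) run) (sym (not-involutive _))) (trans (run-last run) (sym (not-involutive _)))
        c-after)
      where
      regroup : ∀ σ ℓ → suc (σ + ℓ + ℓ) ≡ σ + 2 * ℓ + 1
      regroup = solve-∀
    following : ∃[ m ] m < ℓ × Run τ (suc m) (not (colour j)) × c (suc τ + suc m) ≡ not (not (colour j))
    following = next-run τ ℓ c-after c-after′
    m : ℕ
    m = proj₁ following
    run′ : Run τ ℓ (not (colour j))
    run′ = extend (m <? ℓ-1)
      where
      extend : Dec (m < ℓ-1) → Run τ ℓ (not (colour j))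
      extend (no m≮ℓ-1) i i<ℓ = proj₁ (proj₂ (proj₂ following)) i (≤-trans i<ℓ (s≤s (≮⇒≥ m≮ℓ-1)))
      extend (yes m<ℓ-1) = ⊥-elim (shorter-run-absurd (<-wellFounded _) σ ℓ-1 (s≤s m<ℓ-1) N≤σ bound′ run
                                    (proj₁ (proj₂ (proj₂ following)))
                                    (trans (proj₂ (proj₂ (proj₂ following))) (not-involutive _)))
        where
        bound′ : σ + ℓ + 2 * suc m + 2 ≤ Z
        bound′ = ≤-trans (+-monoˡ-≤ 2 (+-monoʳ-≤ τ (≤-trans (*-monoʳ-≤ 2 (proj₁ (proj₂ following))) (m≤n+m (2 * ℓ) ℓ))))
                         (≤-trans (≤-reflexive (regroup τ ℓ)) bound)
          where
          regroup : ∀ τ ℓ → τ + (ℓ + 2 * ℓ) + 2 ≡ τ + 3 * ℓ + 2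
          regroup = solve-∀

  first-block : IsBlock 0
  first-block = proj₁ (proj₂ (proj₂ second-run)) , trans cs (sym (not-involutive A)) , proj₂ (proj₂ (proj₂ second-run))

  blocks-below-Z : ∀ j → base j + 3 * ℓ + 2 ≤ Z → IsBlock j
  blocks-below-Z zero _ = first-block
  blocks-below-Z (suc j) bound =
    next-block j (blocks-below-Z j (≤-trans (+-monoˡ-≤ 2 (+-monoˡ-≤ (3 * ℓ) (m≤m+n (base j) ℓ))) bound)) bound

  K : ℕ
  K = 16 * N * N

  N²≤K : N * N ≤ K
  N²≤K = *-monoˡ-≤ N (m≤n*m N 16)

  ℓ≤K : ℓ ≤ K
  ℓ≤K = ≤-trans ℓ≤s+N (≤-trans (+-mono-≤ (≤-trans (n≤1+n s) s<2N²) N≤N²)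
                                (≤-trans (≤-reflexive (collect N)) (*-monoˡ-≤ N (*-monoˡ-≤ N (m≤m+n 3 13)))))
    where
    collect : ∀ N → 2 * N * N + N * N ≡ 3 * N * N
    collect = solve-∀

  block : ∀ j → base j ≤ K → IsBlock j
  block j base≤K = blocks-below-Z j (begin
    base j + 3 * ℓ + 2        ≤⟨ +-monoˡ-≤ 2 (+-mono-≤ base≤K (*-monoʳ-≤ 3 ℓ≤K)) ⟩
    K + 3 * K + 2              ≡⟨ collect N ⟩
    64 * (N * N) + 2           ≤⟨ +-monoʳ-≤ (64 * (N * N)) (≤-trans (m≤m+n 2 34) (*-monoʳ-≤ 36 (*-mono-≤ 1≤N 1≤N))) ⟩
    64 * (N * N) + 36 * (N * N) ≡⟨ collect′ N ⟩
    Z                          ∎)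
    where
    open ≤-Reasoning
    collect : ∀ N → 16 * N * N + 3 * (16 * N * N) + 2 ≡ 64 * (N * N) + 2
    collect = solve-∀
    collect′ : ∀ N → 64 * (N * N) + 36 * (N * N) ≡ 100 * N * N
    collect′ = solve-∀

  locate : ∀ y → s < y → ∃[ q ] ∃[ r ] r < ℓ × y ≡ suc (base q + r)
  locate y s<y =
    let (q , r , r<ℓ , y≡) = divide-above (suc s) ℓ s<y
    in q , r , r<ℓ , trans y≡ (trans (regroup s r q ℓ) (cong (λ t → suc (t + r)) (sym (base-≡ q))))
    where
    regroup : ∀ s r q ℓ → suc s + r + q * ℓ ≡ suc (s + q * ℓ + r)
    regroup = solve-∀

  z≤4N⇒z²≤K : ∀ {z} → z ≤ 4 * N → z * z ≤ K
  z≤4N⇒z²≤K {z} z≤4N = ≤-trans (*-mono-≤ z≤4N z≤4N) (≤-reflexive (collect N))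
    where
    collect : ∀ N → 4 * N * (4 * N) ≡ 16 * N * N
    collect = solve-∀

  z≤4N⇒z≤Z : ∀ {z} → z ≤ 4 * N → z ≤ Z
  z≤4N⇒z≤Z z≤4N = ≤-trans z≤4N (≤-trans (subst (_≤ 4 * N * N) (*-identityʳ (4 * N)) (*-monoʳ-≤ (4 * N) 1≤N))
                                        (*-monoˡ-≤ N (*-monoˡ-≤ N (m≤m+n 4 96))))

  block-pair-absurd : ∀ z j q u v → u < ℓ → v < ℓ → N ≤ z → z ≤ 4 * N → c z ≡ colour j →
    z * z ≡ 2 * suc s + (u + v) + (j + q) * (2 * ℓ) → ⊥
  block-pair-absurd z j q u v u<ℓ v<ℓ N≤z z≤4N cz z²≡ =
    b≢not-b (trans (sym cy) (trans (flip-colour N≤x N≤y N≤z (z≤4N⇒z≤Z z≤4N) x+y≡z² (trans cx (sym cz))) (cong not cz)))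
    where
    j′ : ℕ
    j′ = j + 2 * q
    x y : ℕ
    x = suc (base j + u)
    y = suc (base j′ + v)
    x+y≡z² : x + y ≡ z * z
    x+y≡z² = begin
      suc (base j + u) + suc (base j′ + v)                ≡⟨ cong₂ (λ a b → suc (a + u) + suc (b + v)) (base-≡ j) (base-≡ j′) ⟩
      suc (s + j * ℓ + u) + suc (s + j′ * ℓ + v)            ≡⟨ regroup s j q ℓ u v ⟩
      2 * suc s + (u + v) + (j + q) * (2 * ℓ)               ≡⟨ z²≡ ⟨
      z * z                                                 ∎
      where
      open ≡-Reasoning
      regroup : ∀ s j q ℓ u v → suc (s + j * ℓ + u) + suc (s + (j + 2 * q) * ℓ + v)
                                ≡ 2 * suc s + (u + v) + (j + q) * (2 * ℓ)
      regroup = solve-∀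
    base≤K : ∀ i w → suc (base i + w) ≤ z * z → base i ≤ K
    base≤K i w h = ≤-trans (m≤m+n (base i) w) (≤-trans (n≤1+n _) (≤-trans h (z≤4N⇒z²≤K z≤4N)))
    cx : c x ≡ colour j
    cx = proj₁ (block j (base≤K j u (subst (x ≤_) x+y≡z² (m≤m+n x y)))) u u<ℓ
    cy : c y ≡ colour j
    cy = trans (proj₁ (block j′ (base≤K j′ v (subst (y ≤_) x+y≡z² (m≤n+m y x)))) v v<ℓ) (colour-periodic j q)
    N≤x : N ≤ x
    N≤x = ≤-trans N≤s (≤-trans (s≤base j) (≤-trans (m≤m+n (base j) u) (n≤1+n _)))
    N≤y : N ≤ y
    N≤y = ≤-trans N≤s (≤-trans (s≤base j′) (≤-trans (m≤m+n (base j′) v) (n≤1+n _)))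

  block-decomposition-absurd : ∀ z j q r → N ≤ z → z ≤ 4 * N → c z ≡ colour j →
    z * z ≡ 2 * suc s + r + (j + q) * (2 * ℓ) → suc r < 2 * ℓ → ⊥
  block-decomposition-absurd z j q r N≤z z≤4N cz z²≡ r+1<2ℓ =
    let (u , v , u+v≡r , u<ℓ , v<ℓ) = split-below ℓ r r+1<2ℓ
    in block-pair-absurd z j q u v u<ℓ v<ℓ N≤z z≤4N cz
         (trans z²≡ (cong (λ w → 2 * suc s + w + (j + q) * (2 * ℓ)) (sym u+v≡r)))

  colour-A-just-above : ∀ y₀ → s < y₀ → y₀ ≤ K → ∃[ y ] c y ≡ A × y₀ ≤ y × y ≤ y₀ + ℓ
  colour-A-just-above y₀ s<y₀ y₀≤K = in-block (locate y₀ s<y₀)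
    where
    in-block : (∃[ q ] ∃[ r ] r < ℓ × y₀ ≡ suc (base q + r)) → ∃[ y ] c y ≡ A × y₀ ≤ y × y ≤ y₀ + ℓ
    in-block (q , r , r<ℓ , y₀≡) = pick (colour q ≟ᵇ A)
      where
      the-block : IsBlock q
      the-block = block q (≤-trans (m≤m+n (base q) r) (≤-trans (n≤1+n _) (≤-trans (≤-reflexive (sym y₀≡)) y₀≤K)))
      pick : Dec (colour q ≡ A) → ∃[ y ] c y ≡ A × y₀ ≤ y × y ≤ y₀ + ℓ
      pick (yes colour≡A) = y₀ , trans (cong c y₀≡) (trans (proj₁ the-block r r<ℓ) colour≡A) , ≤-refl , m≤m+n y₀ ℓ
      pick (no colour≢A) =
        suc (base q + ℓ) , trans (proj₂ (proj₂ the-block)) (trans (cong not (¬-not colour≢A)) (not-involutive A)) ,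
        subst (_≤ suc (base q + ℓ)) (sym y₀≡) (s≤s (+-monoʳ-≤ (base q) (<⇒≤ r<ℓ))) ,
        subst (suc (base q + ℓ) ≤_) (cong (_+ ℓ) (sym y₀≡)) (s≤s (+-monoˡ-≤ ℓ (m≤m+n (base q) r)))

  -- Either x = N² - y with z = N, or x = (N+1)² - y with z = N + 1, and then x ∈ [N, s].
  colour-A-near-N²-absurd : ∀ {y} → 3 * N ≤ s → N ≤ y → N * N ≤ s + y → y ≤ N * N + N → c y ≡ A → ⊥
  colour-A-near-N²-absurd {y} 3N≤s N≤y N²≤s+y y≤N²+N cy = by-cases (y + N ≤? N * N)
    where
    by-cases : Dec (y + N ≤ N * N) → ⊥
    by-cases (yes y+N≤N²) = b≢not-b (trans (sym cy) (flip-colour N≤x N≤y ≤-refl N≤Z x+y≡N² (initial x N≤x x≤s)))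
      where
      x : ℕ
      x = N * N ∸ y
      x+y≡N² : x + y ≡ N * N
      x+y≡N² = m∸n+n≡m (≤-trans (m≤m+n y N) y+N≤N²)
      N≤x : N ≤ x
      N≤x = +-cancelʳ-≤ y N x (subst (N + y ≤_) (sym x+y≡N²) (subst (_≤ N * N) (+-comm y N) y+N≤N²))
      x≤s : x ≤ s
      x≤s = +-cancelʳ-≤ y x s (subst (_≤ s + y) (sym x+y≡N²) N²≤s+y)
    by-cases (no y+N≰N²) = b≢not-b (trans (sym cy)
            (trans (flip-colour N≤x N≤y (n≤1+n N) (≤-trans N+1≤s (≤-trans (n≤1+n s) (≤-trans s<2N² 2N²≤Z)))
                     x+y≡[N+1]² (trans (initial x N≤x x≤s) (sym cN+1)))
                   (cong not cN+1)))
      where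
      N+1≤s : suc N ≤ s
      N+1≤s = ≤-trans (≤-trans (≤-reflexive (+-comm 1 N)) (+-monoʳ-≤ N (≤-trans 1≤N (m≤m+n N (N + 0))))) 3N≤s
      cN+1 : c (suc N) ≡ A
      cN+1 = initial (suc N) (n≤1+n N) N+1≤s
      square-of-successor : ∀ N → suc N * suc N ≡ N * N + N + suc N
      square-of-successor = solve-∀
      x : ℕ
      x = suc N * suc N ∸ y
      x+y≡[N+1]² : x + y ≡ suc N * suc N
      x+y≡[N+1]² = m∸n+n≡m (≤-trans y≤N²+N (≤-trans (m≤m+n (N * N + N) (suc N)) (≤-reflexive (sym (square-of-successor N)))))
      N≤x : N ≤ x
      N≤x = +-cancelʳ-≤ y N x (begin
        N + y                   ≤⟨ +-monoʳ-≤ N y≤N²+N ⟩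
        N + (N * N + N)         ≤⟨ ≤-trans (≤-reflexive (+-comm N _)) (+-monoʳ-≤ (N * N + N) (n≤1+n N)) ⟩
        N * N + N + suc N       ≡⟨ square-of-successor N ⟨
        suc N * suc N           ≡⟨ x+y≡[N+1]² ⟨
        x + y                   ∎)
        where open ≤-Reasoning
      x≤s : x ≤ s
      x≤s = ≤-trans (+-cancelʳ-≤ (suc (N * N)) x (3 * N) (begin
        x + suc (N * N)         ≤⟨ +-monoʳ-≤ x (≰⇒> y+N≰N²) ⟩
        x + (y + N)             ≡⟨ +-assoc x y N ⟨
        x + y + N               ≡⟨ cong (_+ N) x+y≡[N+1]² ⟩
        suc N * suc N + N       ≡⟨ regroup N ⟩
        3 * N + suc (N * N)     ∎)) 3N≤s
        where
        open ≤-Reasoning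
        regroup : ∀ N → suc N * suc N + N ≡ 3 * N + suc (N * N)
        regroup = solve-∀

  large-s-absurd : 3 * N ≤ s → ⊥
  large-s-absurd 3N≤s = conclude (colour-A-just-above y₀ s<y₀ (≤-trans y₀≤N² N²≤K))
    where
    s≤N² : s ≤ N * N
    s≤N² = ≤-trans (m≤m+n s (s + 0)) (<⇒≤ 2s<N²)
    y₀ : ℕ
    y₀ = N * N ∸ s
    s+y₀≡N² : s + y₀ ≡ N * N
    s+y₀≡N² = m+[n∸m]≡n s≤N²
    s<y₀ : s < y₀
    s<y₀ = +-cancelˡ-≤ s (suc s) y₀ (subst (s + suc s ≤_) (sym s+y₀≡N²) (subst (_≤ N * N) (regroup s) 2s<N²))
      where
      regroup : ∀ s → suc (2 * s) ≡ s + suc s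
      regroup = solve-∀
    y₀≤N² : y₀ ≤ N * N
    y₀≤N² = subst (y₀ ≤_) s+y₀≡N² (m≤n+m y₀ s)
    y₀+ℓ≤N²+N : y₀ + ℓ ≤ N * N + N
    y₀+ℓ≤N²+N = ≤-trans (+-monoʳ-≤ y₀ ℓ≤s+N)
                        (≤-reflexive (trans (sym (+-assoc y₀ s N)) (cong (_+ N) (trans (+-comm y₀ s) s+y₀≡N²))))
    conclude : (∃[ y ] c y ≡ A × y₀ ≤ y × y ≤ y₀ + ℓ) → ⊥
    conclude (y , cy , y₀≤y , y≤y₀+ℓ) =
      colour-A-near-N²-absurd 3N≤s (≤-trans N≤s (≤-trans (n≤1+n s) (≤-trans s<y₀ y₀≤y)))
        (subst (_≤ s + y) s+y₀≡N² (+-monoʳ-≤ s y₀≤y)) (≤-trans y≤y₀+ℓ y₀+ℓ≤N²+N) cy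

  -- With P = s + 1 and T = 2ℓ, write P² and (P+1)² as 2P + r + qT with r < T.  Unless r = T - 1,
  -- block-decomposition-absurd applies; r = T - 1 for both is impossible as (P+1)² - P² is odd.
  module SmallInitialRun (s<3N : s < 3 * N) where
    P T : ℕ
    P = suc s
    T = 2 * ℓ

    N≤P : N ≤ P
    N≤P = ≤-trans N≤s (n≤1+n s)

    P≤4N : P ≤ 4 * N
    P≤4N = ≤-trans s<3N (*-monoˡ-≤ N (m≤m+n 3 1))

    P+1≤4N : suc P ≤ 4 * N
    P+1≤4N = ≤-trans (s≤s s<3N) (≤-trans (≤-reflexive (+-comm 1 (3 * N))) (≤-trans (+-monoʳ-≤ (3 * N) 1≤N) (≤-reflexive (collect N))))
      where
      collect : ∀ N → 3 * N + N ≡ 4 * N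
      collect = solve-∀

    square-of-successor : ∀ P → suc P * suc P ≡ P * P + (2 * P + 1)
    square-of-successor = solve-∀

    2P≤P² : 2 * P ≤ P * P
    2P≤P² = *-monoˡ-≤ P (≤-trans (m≤n+m 2 8) (≤-trans 10≤N N≤P))

    2P+2≤[P+1]² : 2 * P + 2 ≤ suc P * suc P
    2P+2≤[P+1]² = begin
      2 * P + 2             ≡⟨ +-comm (2 * P) 2 ⟩
      2 + 2 * P             ≤⟨ +-monoˡ-≤ (2 * P) (≤-trans (*-monoʳ-≤ 2 (≤-trans 1≤N N≤P)) 2P≤P²) ⟩
      P * P + 2 * P         ≤⟨ +-monoʳ-≤ (P * P) (m≤m+n (2 * P) 1) ⟩
      P * P + (2 * P + 1)   ≡⟨ square-of-successor P ⟨
      suc P * suc P         ∎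
      where open ≤-Reasoning

    cP : c P ≡ colour 0
    cP = run-first (s≤s z≤n) (proj₁ first-block)

    residue-is-T-1 : ∀ {r} → r < T → ¬ (suc r < T) → suc r ≡ T
    residue-is-T-1 r<T r+1≮T = ≤-antisym r<T (≮⇒≥ r+1≮T)

    same-residue-absurd : ∀ q₀ q₁ {r} → P * P ≡ 2 * P + r + q₀ * T → suc P * suc P ≡ 2 * P + r + q₁ * T → ⊥
    same-residue-absurd q₀ q₁ {r} P²≡ [P+1]²≡ = even≢odd (q₁ * ℓ) (q₀ * ℓ + P) (+-cancelˡ-≡ (2 * P + r) _ _ (begin
      2 * P + r + 2 * (q₁ * ℓ)             ≡⟨ double-ℓ (2 * P + r) q₁ ℓ ⟩
      2 * P + r + q₁ * T                   ≡⟨ [P+1]²≡ ⟨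
      suc P * suc P                        ≡⟨ square-of-successor P ⟩
      P * P + (2 * P + 1)                  ≡⟨ cong (_+ (2 * P + 1)) P²≡ ⟩
      2 * P + r + q₀ * T + (2 * P + 1)     ≡⟨ regroup P r q₀ ℓ ⟩
      2 * P + r + suc (2 * (q₀ * ℓ + P))   ∎))
      where
      open ≡-Reasoning
      double-ℓ : ∀ a q ℓ → a + 2 * (q * ℓ) ≡ a + q * (2 * ℓ)
      double-ℓ = solve-∀
      regroup : ∀ P r q ℓ → 2 * P + r + q * (2 * ℓ) + (2 * P + 1) ≡ 2 * P + r + suc (2 * (q * ℓ + P))
      regroup = solve-∀
    -- P + 1 lies in block 0 if ℓ ≥ 2 and is the first element of block 1 if ℓ = 1.
    P+1-absurd : ∀ q r → suc P * suc P ≡ 2 * P + r + q * T → suc r < T → Dec (1 ≤ ℓ-1) → ⊥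
    P+1-absurd q r [P+1]²≡ r+1<T (yes 1≤ℓ-1) =
      block-decomposition-absurd (suc P) 0 q r (≤-trans N≤P (n≤1+n P)) P+1≤4N cP+1 [P+1]²≡ r+1<T
      where
      cP+1 : c (suc P) ≡ colour 0
      cP+1 = trans (cong (λ t → c (suc t)) (+-comm 1 s)) (proj₁ first-block 1 (s≤s 1≤ℓ-1))
    P+1-absurd zero r [P+1]²≡ r+1<T (no 1≰ℓ-1) =
      <⇒≱ (subst (suc r <_) (cong (λ k → 2 * suc k) (n≤0⇒n≡0 (≤-pred (≰⇒> 1≰ℓ-1)))) r+1<T) (≤-trans 2≤r (n≤1+n r))
      where
      2≤r : 2 ≤ r
      2≤r = +-cancelˡ-≤ (2 * P) 2 r (≤-trans 2P+2≤[P+1]² (≤-reflexive (trans [P+1]²≡ (+-identityʳ (2 * P + r)))))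
    P+1-absurd (suc q′) r [P+1]²≡ r+1<T (no 1≰ℓ-1) =
      block-decomposition-absurd (suc P) 1 q′ r (≤-trans N≤P (n≤1+n P)) P+1≤4N cP+1 [P+1]²≡ r+1<T
      where
      base1+0≡P+1 : suc (base 1 + 0) ≡ suc P
      base1+0≡P+1 = cong suc (trans (+-identityʳ (s + ℓ))
        (trans (cong (λ k → s + suc k) (n≤0⇒n≡0 (≤-pred (≰⇒> 1≰ℓ-1)))) (+-comm s 1)))
      4N≤K : 4 * N ≤ K
      4N≤K = ≤-trans (subst (_≤ 4 * N * N) (*-identityʳ (4 * N)) (*-monoʳ-≤ (4 * N) 1≤N))
                     (*-monoˡ-≤ N (*-monoˡ-≤ N (m≤m+n 4 12)))
      cP+1 : c (suc P) ≡ colour 1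
      cP+1 = trans (cong c (sym base1+0≡P+1))
        (proj₁ (block 1 (≤-trans (m≤m+n (base 1) 0) (≤-trans (≤-pred (≤-reflexive base1+0≡P+1)) (≤-trans P≤4N 4N≤K)))) 0 (s≤s z≤n))

    Residue : ℕ → Set
    Residue z = ∃[ q ] ∃[ r ] r < T × z * z ≡ 2 * P + r + q * T

    residues-absurd : Residue P → Residue (suc P) → ⊥
    residues-absurd (q₀ , r₀ , r₀<T , P²≡) (q₁ , r₁ , r₁<T , [P+1]²≡) = by-cases (suc r₀ <? T) (suc r₁ <? T)
      where
      by-cases : Dec (suc r₀ < T) → Dec (suc r₁ < T) → ⊥
      by-cases (yes r₀+1<T) _ = block-decomposition-absurd P 0 q₀ r₀ N≤P P≤4N cP P²≡ r₀+1<T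
      by-cases (no _) (yes r₁+1<T) = P+1-absurd q₁ r₁ [P+1]²≡ r₁+1<T (1 ≤? ℓ-1)
      by-cases (no r₀+1≮T) (no r₁+1≮T) =
        same-residue-absurd q₀ q₁ P²≡ (subst (λ r → suc P * suc P ≡ 2 * P + r + q₁ * T)
                          (suc-injective (trans (residue-is-T-1 r₁<T r₁+1≮T) (sym (residue-is-T-1 r₀<T r₀+1≮T))))
                          [P+1]²≡)

    small-s-absurd : ⊥
    small-s-absurd =
      residues-absurd (divide-above (2 * P) T 2P≤P²) (divide-above (2 * P) T (≤-trans (m≤m+n (2 * P) 2) 2P+2≤[P+1]²))

  absurd : ⊥
  absurd = [ SmallInitialRun.small-s-absurd , large-s-absurd ]′ (<-≤-connex s (3 * N))

mono-solution : ∀ N → 10 ≤ N → ∀ c → MonoSolutionIn N c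
mono-solution N 10≤N c = decidable-stable (mono-solution-in? N c) λ no-solution →
  FlippingColouring.absurd N 10≤N c (no-mono-solution⇒flips (≤-trans (s≤s z≤n) 10≤N) no-solution)

infinitely-many-mono-solutions : ∀ c → InfinitelyManyMonoSols c
infinitely-many-mono-solutions c B = large (mono-solution (B + 10) (m≤n+m 10 B) c)
  where
  positive : ∀ {n} → B + 10 ≤ n → 1 ≤ n
  positive B+10≤n = ≤-trans (s≤s z≤n) (≤-trans (m≤n+m 10 B) B+10≤n)
  large : MonoSolutionIn (B + 10) c → ∃[ x ] ∃[ y ] ∃[ z ] (Pos x × Pos y × Pos z × B < x + y + z × MonoSol c x y z)
  large (x , y , z , (N≤x , _) , (N≤y , _) , (N≤z , _) , solution) =
    x , y , z , positive N≤x , positive N≤y , positive N≤z , B<x+y+z , solution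
    where
    B<x+y+z : B < x + y + z
    B<x+y+z = ≤-trans (≤-trans (≤-reflexive (+-comm 1 B)) (+-monoʳ-≤ B (m≤m+n 1 9)))
                      (≤-trans N≤x (≤-trans (m≤m+n x y) (m≤m+n (x + y) z)))

theorem1 : ((c : ℕ → Bool) → InfinitelyManyMonoSols c)
    × (∃[ N₀ ] ((N : ℕ) → N₀ ≤ N → (c : ℕ → Bool) →
        ∃[ x ] ∃[ y ] ∃[ z ]
          (InInterval N (10000 * N ^ 4) x × InInterval N (10000 * N ^ 4) y
            × InInterval N (10000 * N ^ 4) z × MonoSol c x y z)))
theorem1 = infinitely-many-mono-solutions , 10 , mono-solution
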